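{- Let $P$ be a finite poset and let $h=h(P)$. If $P$ is thin, then for all $n\ge h$, \[ M_1(P,n)=\binom{n-h}{\lfloor (n-h)/2\rfloor}. \] If $P$ is slim, then for all $n\ge h$, \[ M_1(P,n)=M_2(P,n)=\binom{n-h}{\lfloor (n-h)/2\rfloor}. \]
   Context: $B_n$ denotes the poset of all subsets of $[n]$ ordered by inclusion. For a finite poset $(P,<_p)$, an embedding $f:P\to B_n$ is an injective map with $f(a)\subset f(b)$ whenever $a<_p b$; an induced embedding is an injective map with $f(a)\subset f(b)$ if and only if $a<_p b$. Two sets $X,Y$ of subsets of $[n]$ are incomparable if there are no $x\in X$, $y\in Y$ with $x\subseteq y$ or $y\subseteq x$; a family of sets of subsets is incomparable if its members are pairwise incomparable. $M_1(P,n)$ (resp. $M_2(P,n)$) is the largest $M$ such that there exist embeddings (resp. induced embeddings) $f_1,\dots,f_M:P\to B_n$ with $\{\mathrm{Im}(f_i)\}_{i=1}^M$ an incomparable family. The height $h(P)$ is the number of elements in a longest chain of $P$ minus $1$. $P$ is thin if it has an embedding into $B_{h(P)}$, and slim if it has an induced embedding into $B_{h(P)}$. -}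

module Defs where

open import Data.Nat using (ℕ; zero; suc; _≤_; _∸_; _/_)
open import Data.Nat.Combinatorics using (_C_)
open import Data.Fin using (Fin; zero; suc) renaming (_≤_ to _≤F_)
open import Data.Fin.Subset using (Subset; _⊆_; _⊂_)
open import Data.Vec using (Vec; []; _∷_)
open import Data.Product using (_×_; Σ; ∃)
open import Data.Empty using (⊥)
open import Data.Unit using (⊤)
open import Function.Definitions using (Injective)
open import Relation.Binary.PropositionalEquality using (_≡_; _≢_)
open import Relation.Nullary using (¬_)

record FinPoset : Set₁ where
  field
    size   : ℕ
    _<ₚ_   : Fin size → Fin size → Set
    irrefl : ∀ a → ¬ (a <ₚ a)
    trans  : ∀ {a b c} → a <ₚ b → b <ₚ c → a <ₚ c
open FinPoset public

IsChain : (P : FinPoset) → {m : ℕ} → Vec (Fin (size P)) m → Set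
IsChain P []           = ⊤
IsChain P (x ∷ [])     = ⊤
IsChain P (x ∷ y ∷ xs) = _<ₚ_ P x y × IsChain P (y ∷ xs)

IsHeight : FinPoset → ℕ → Set
IsHeight P h =
  (Σ (Vec (Fin (size P)) (suc h)) (IsChain P)) ×
  (∀ m → (c : Vec (Fin (size P)) m) → IsChain P c → m ≤ suc h)

IsEmbedding : (P : FinPoset) (n : ℕ) → (Fin (size P) → Subset n) → Set
IsEmbedding P n f =
  Injective _≡_ _≡_ f × (∀ a b → _<ₚ_ P a b → f a ⊂ f b)

IsInducedEmbedding : (P : FinPoset) (n : ℕ) → (Fin (size P) → Subset n) → Set
IsInducedEmbedding P n f =
  Injective _≡_ _≡_ f ×
  (∀ a b → _<ₚ_ P a b → f a ⊂ f b) ×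
  (∀ a b → f a ⊂ f b → _<ₚ_ P a b)

Thin : FinPoset → ℕ → Set
Thin P h = ∃ λ (f : Fin (size P) → Subset h) → IsEmbedding P h f

Slim : FinPoset → ℕ → Set
Slim P h = ∃ λ (f : Fin (size P) → Subset h) → IsInducedEmbedding P h f

-- The images of fᵢ (i : Fin M) form an incomparable family:
-- for i ≠ j there are no x ∈ Im fᵢ, y ∈ Im fⱼ with x ⊆ y
-- (the case y ⊆ x is covered by swapping i and j).
IncomparableFamily : (P : FinPoset) (n M : ℕ) → (Fin M → Fin (size P) → Subset n) → Set
IncomparableFamily P n M fs =
  ∀ i j → i ≢ j → ∀ a b → ¬ (fs i a ⊆ fs j b)

IsLargest : (P : FinPoset) (n : ℕ) → ((Fin (size P) → Subset n) → Set) → ℕ → Set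
IsLargest P n Emb M =
  (∃ λ (fs : Fin M → Fin (size P) → Subset n) →
      (∀ i → Emb (fs i)) × IncomparableFamily P n M fs) ×
  (∀ M' (fs : Fin M' → Fin (size P) → Subset n) →
      (∀ i → Emb (fs i)) → IncomparableFamily P n M' fs → M' ≤ M)

IsM₁ : FinPoset → ℕ → ℕ → Set
IsM₁ P n = IsLargest P n (IsEmbedding P n)

IsM₂ : FinPoset → ℕ → ℕ → Set
IsM₂ P n = IsLargest P n (IsInducedEmbedding P n)

centralBinom : ℕ → ℕ
centralBinom m = m C (m / 2)

module Submission where

-- For an embedding f of P into B_n, let A = f(bottom) and B = f(top) for a longest chain of P.
-- Then A ⊆ B and ∣B ∖ A∣ ≥ h, and incomparability of the images gives A_i ⊄ B_j for i ≠ j.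
-- This is Bollobás' set-pair condition for the pairs (A_i, [n] ∖ B_i), so
-- Σ_i 1 / C(a_i + c_i, a_i) ≤ 1 where a_i = ∣A_i∣ and c_i = n − ∣B_i∣; as a_i + c_i ≤ n − h,
-- each of these binomial coefficients is at most C(n − h, ⌊(n − h)/2⌋).
-- Bollobás' inequality is proved in the form Σ_i n! / C(a_i + c_i, a_i) ≤ n! by induction on n:
-- when B ≠ [n], the weight of a pair is the sum, over the points x outside A, of the weights of
-- the pair with x deleted, and deleting x keeps the surviving pairs crossing.
-- Conversely, appending the ⌊m/2⌋-subsets of m new points to an (induced) embedding into B_h
-- gives C(m, ⌊m/2⌋) (induced) embeddings into B_(h+m) with incomparable images.

open import Defs hiding (trans)

open import Data.Bool using (Bool; true; false)
open import Data.Fin using (Fin; zero; suc; punchOut; splitAt; join; cast)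
open import Data.Fin.Properties using (join-splitAt; cast-involutive)
open import Data.Fin.Subset using (Subset; _⊆_; _⊂_; _∈_; _∉_; ∣_∣; inside; outside; ⊥)
open import Data.Fin.Subset.Properties
  using ( drop-there; drop-∷-⊆; drop-∷-⊂; out⊆; in⊆in; out⊂; s⊂s; out⊂in; ⊆-refl; ⊆-trans
        ; p⊆q⇒∣p∣≤∣q∣; p⊂q⇒p⊆q; p⊂q⇒∣p∣<∣q∣; ∣⊥∣≡0 )
open import Data.List using (List; []; _∷_; map; catMaybes; mapMaybe; tabulate)
open import Data.List.Properties using (map-∘; map-cong-local)
open import Data.List.Relation.Unary.All as All using (All; []; _∷_)
open import Data.List.Relation.Unary.AllPairs as AllPairs using (AllPairs; []; _∷_)
import Data.List.Relation.Unary.AllPairs.Properties as AllPairs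
open import Data.Maybe using (Maybe; just; nothing; maybe′)
open import Data.Maybe.Relation.Binary.Connected
  using (Connected; just; just-nothing; nothing-just; nothing)
open import Data.Nat
open import Data.Nat.Combinatorics
  using (_C_; nCk≡n!/k![n-k]!; k![n∸k]!∣n!; nCk≡nC[n∸k]; k>n⇒nCk≡0; nCk+nC[k+1]≡[n+1]C[k+1])
open import Data.Nat.DivMod using (m/n*n≡m; m/n≡1+[m∸n]/n)
open import Data.Nat.ListAction using (sum)
open import Data.Nat.Properties
open import Data.Nat.Solver using (module +-*-Solver)
open import Data.Product using (_×_; _,_; ∃; proj₁; proj₂)
open import Data.Sum using (_⊎_; inj₁; inj₂)
open import Data.Vec using (Vec; []; _∷_; lookup; removeAt; zipWith; _++_; head; last; here; there)
open import Data.Vec.Properties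
  using (++-injectiveˡ; removeAt-punchOut; lookup-zipWith; []=⇒lookup; lookup⇒[]=)
open import Function using (_∘_)
open import Relation.Binary.PropositionalEquality
open import Relation.Nullary using (¬_; yes; no; contradiction)

open +-*-Solver
open import Algebra.Properties.CommutativeSemigroup +-commutativeSemigroup
  using () renaming (x∙yz≈y∙xz to x+[y+z]≡y+[x+z])
open import Algebra.Properties.CommutativeSemigroup *-commutativeSemigroup
  using () renaming (x∙yz≈y∙xz to x*[y*z]≡y*[x*z])
open import Algebra.Properties.Semiring.Sum +-*-semiring
  using (sum-syntax; sum-cong-≗; ∑-distrib-+; sum-replicate-zero; *-distribʳ-sum)

-- Binomial coefficients

nCk*k![n∸k]!≡n! : ∀ {n k} → k ≤ n → (n C k) * (k ! * (n ∸ k) !) ≡ n !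
nCk*k![n∸k]!≡n! {n} {k} k≤n = begin
  (n C k) * (k ! * (n ∸ k) !)                 ≡⟨ cong (_* (k ! * (n ∸ k) !)) (nCk≡n!/k![n-k]! k≤n) ⟩
  n ! / (k ! * (n ∸ k) !) * (k ! * (n ∸ k) !) ≡⟨ m/n*n≡m (k![n∸k]!∣n! k≤n) ⟩
  n !                                         ∎
  where
  open ≡-Reasoning
  instance _ = k !* (n ∸ k) !≢0

[a+c]Ca*a!*c!≡[a+c]! : ∀ a c → ((a + c) C a) * (a ! * c !) ≡ (a + c) !
[a+c]Ca*a!*c!≡[a+c]! a c =
  subst (λ m → ((a + c) C a) * (a ! * m !) ≡ (a + c) !) (m+n∸m≡n a c)
        (nCk*k![n∸k]!≡n! (m≤m+n a c))

C-ratio : ∀ a c → ((a + suc c) C suc a) * suc a ≡ ((a + suc c) C a) * suc c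
C-ratio a c = *-cancelʳ-≡ _ _ (a ! * c !) {{a !* c !≢0}} (begin
  ((a + suc c) C suc a) * suc a * (a ! * c !)
    ≡⟨ solve 4 (λ x s f g → x :* s :* (f :* g) := x :* ((s :* f) :* g))
               refl ((a + suc c) C suc a) (suc a) (a !) (c !) ⟩
  ((a + suc c) C suc a) * (suc a ! * c !)
    ≡⟨ cong (λ m → (m C suc a) * (suc a ! * c !)) (+-suc a c) ⟩
  ((suc a + c) C suc a) * (suc a ! * c !)
    ≡⟨ [a+c]Ca*a!*c!≡[a+c]! (suc a) c ⟩
  (suc a + c) !
    ≡⟨ cong _! (+-suc a c) ⟨
  (a + suc c) !
    ≡⟨ [a+c]Ca*a!*c!≡[a+c]! a (suc c) ⟨
  ((a + suc c) C a) * (a ! * suc c !)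
    ≡⟨ solve 4 (λ x s f g → x :* (f :* (s :* g)) := x :* s :* (f :* g))
               refl ((a + suc c) C a) (suc c) (a !) (c !) ⟩
  ((a + suc c) C a) * suc c * (a ! * c !) ∎)
  where open ≡-Reasoning

C-increasing : ∀ a c → a ≤ c → (a + suc c) C a ≤ (a + suc c) C suc a
C-increasing a c a≤c = *-cancelʳ-≤ _ _ (suc a) (begin
  ((a + suc c) C a) * suc a     ≤⟨ *-monoʳ-≤ ((a + suc c) C a) (s≤s a≤c) ⟩
  ((a + suc c) C a) * suc c     ≡⟨ C-ratio a c ⟨
  ((a + suc c) C suc a) * suc a ∎)
  where open ≤-Reasoning

[2+n]/2≡1+n/2 : ∀ n → suc (suc n) / 2 ≡ suc (n / 2)
[2+n]/2≡1+n/2 n = m/n≡1+[m∸n]/n {suc (suc n)} (s≤s (s≤s z≤n))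

[n+n]/2≡n : ∀ n → (n + n) / 2 ≡ n
[n+n]/2≡n zero    = refl
[n+n]/2≡n (suc n) = begin
  suc (n + suc n) / 2   ≡⟨ cong (λ m → suc m / 2) (+-suc n n) ⟩
  suc (suc (n + n)) / 2 ≡⟨ [2+n]/2≡1+n/2 (n + n) ⟩
  suc ((n + n) / 2)     ≡⟨ cong suc ([n+n]/2≡n n) ⟩
  suc n                 ∎
  where open ≡-Reasoning

[n+1+n]/2≡n : ∀ n → (n + suc n) / 2 ≡ n
[n+1+n]/2≡n zero    = refl
[n+1+n]/2≡n (suc n) = begin
  suc (n + suc (suc n)) / 2 ≡⟨ cong (λ m → suc m / 2) (+-suc n (suc n)) ⟩
  suc (suc (n + suc n)) / 2 ≡⟨ [2+n]/2≡1+n/2 (n + suc n) ⟩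
  suc ((n + suc n) / 2)     ≡⟨ cong suc ([n+1+n]/2≡n n) ⟩
  suc n                     ∎
  where open ≡-Reasoning

[a+[a+e]]Ca≤centralBinom : ∀ e a → (a + (a + e)) C a ≤ centralBinom (a + (a + e))
[a+[a+e]]Ca≤centralBinom zero a
  rewrite +-identityʳ a | [n+n]/2≡n a = ≤-refl
[a+[a+e]]Ca≤centralBinom (suc zero) a
  rewrite +-comm a 1 | [n+1+n]/2≡n a = ≤-refl
[a+[a+e]]Ca≤centralBinom (suc (suc e)) a = begin
  (a + n) C a                        ≡⟨ cong (λ m → (a + m) C a) (+-suc a (suc e)) ⟩
  (a + suc (a + suc e)) C a          ≤⟨ C-increasing a (a + suc e) (m≤m+n a (suc e)) ⟩
  (a + suc (a + suc e)) C suc a      ≡⟨ cong (_C suc a) (+-suc a (a + suc e)) ⟩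
  (suc a + (a + suc e)) C suc a      ≡⟨ cong (λ m → (suc a + m) C suc a) (+-suc a e) ⟩
  (suc a + (suc a + e)) C suc a      ≤⟨ [a+[a+e]]Ca≤centralBinom e (suc a) ⟩
  centralBinom (suc a + (suc a + e)) ≡⟨ cong centralBinom a+n≡1+a+[1+a+e] ⟨
  centralBinom (a + n)               ∎
  where
  open ≤-Reasoning
  n = a + suc (suc e)
  a+n≡1+a+[1+a+e] : a + n ≡ suc a + (suc a + e)
  a+n≡1+a+[1+a+e] =
    solve 2 (λ a e → a :+ (a :+ (con 2 :+ e)) := (con 1 :+ a) :+ ((con 1 :+ a) :+ e)) refl a e

[a+c]Ca≤centralBinom : ∀ a c → (a + c) C a ≤ centralBinom (a + c)
[a+c]Ca≤centralBinom a c with ≤-total a c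
... | inj₁ a≤c with m≤n⇒∃[o]m+o≡n a≤c
...   | e , refl = [a+[a+e]]Ca≤centralBinom e a
[a+c]Ca≤centralBinom a c | inj₂ c≤a with m≤n⇒∃[o]m+o≡n c≤a
...   | e , refl = begin
  (c + e + c) C (c + e)               ≡⟨ nCk≡nC[n∸k] (m≤m+n (c + e) c) ⟩
  (c + e + c) C (c + e + c ∸ (c + e)) ≡⟨ cong ((c + e + c) C_) (m+n∸m≡n (c + e) c) ⟩
  (c + e + c) C c                     ≡⟨ cong (_C c) (+-comm (c + e) c) ⟩
  (c + (c + e)) C c                   ≤⟨ [a+[a+e]]Ca≤centralBinom e c ⟩
  centralBinom (c + (c + e))          ≡⟨ cong centralBinom (+-comm c (c + e)) ⟩
  centralBinom (c + e + c)            ∎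
  where open ≤-Reasoning

C≤centralBinom : ∀ n k → n C k ≤ centralBinom n
C≤centralBinom n k with k ≤? n
... | no k≰n rewrite k>n⇒nCk≡0 (≰⇒> k≰n) = z≤n
... | yes k≤n with m≤n⇒∃[o]m+o≡n k≤n
...   | c , refl = [a+c]Ca≤centralBinom k c

nCk≤[1+n]Ck : ∀ n k → n C k ≤ suc n C k
nCk≤[1+n]Ck n zero    = ≤-refl
nCk≤[1+n]Ck n (suc k) =
  subst (n C suc k ≤_) (nCk+nC[k+1]≡[n+1]C[k+1] n k) (m≤n+m (n C suc k) (n C k))

centralBinom-mono : ∀ {m n} → m ≤ n → centralBinom m ≤ centralBinom n
centralBinom-mono {m} {n} m≤n with m≤n⇒∃[o]m+o≡n m≤n
... | e , refl = go e
  where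
  go : ∀ e → centralBinom m ≤ centralBinom (m + e)
  go zero    = ≤-reflexive (cong centralBinom (sym (+-identityʳ m)))
  go (suc e) = begin
    centralBinom m              ≤⟨ go e ⟩
    centralBinom (m + e)        ≤⟨ nCk≤[1+n]Ck (m + e) ((m + e) / 2) ⟩
    suc (m + e) C ((m + e) / 2) ≤⟨ C≤centralBinom (suc (m + e)) ((m + e) / 2) ⟩
    centralBinom (suc (m + e))  ≡⟨ cong centralBinom (+-suc m e) ⟨
    centralBinom (m + suc e)    ∎
    where open ≤-Reasoning

0<nCk : ∀ {n k} → k ≤ n → 0 < n C k
0<nCk {k = zero}        _         = z<s
0<nCk {suc n} {suc k} (s≤s k≤n) =
  subst (0 <_) (nCk+nC[k+1]≡[n+1]C[k+1] n k) (<-≤-trans (0<nCk k≤n) (m≤m+n (n C k) (n C suc k)))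

-- Finite sums

∑-const : ∀ n k → ∑[ x < n ] k ≡ n * k
∑-const zero    k = refl
∑-const (suc n) k = cong (k +_) (∑-const n k)

∑-mono-≤ : ∀ {n} {f g : Fin n → ℕ} → (∀ x → f x ≤ g x) → ∑[ x < n ] f x ≤ ∑[ x < n ] g x
∑-mono-≤ {zero}  f≤g = z≤n
∑-mono-≤ {suc n} f≤g = +-mono-≤ (f≤g zero) (∑-mono-≤ (f≤g ∘ suc))

sum-map-∑ : ∀ {A : Set} {n} (f : Fin n → A → ℕ) (xs : List A) →
            sum (map (λ a → ∑[ x < n ] f x a) xs) ≡ ∑[ x < n ] sum (map (f x) xs)
sum-map-∑ {n = n} f []       = sym (sum-replicate-zero n)
sum-map-∑         f (a ∷ xs) =
  trans (cong (_ +_) (sum-map-∑ f xs)) (sym (∑-distrib-+ (λ x → f x a) (λ x → sum (map (f x) xs))))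

sum-map-tabulate : ∀ {A : Set} {M} (f : A → ℕ) (v : Fin M → A) →
                   sum (map f (tabulate v)) ≡ ∑[ i < M ] f (v i)
sum-map-tabulate {M = zero}  f v = refl
sum-map-tabulate {M = suc M} f v = cong (f (v zero) +_) (sum-map-tabulate f (v ∘ suc))

connected : ∀ {A : Set} {R : A → A → Set} (m m′ : Maybe A) →
            (∀ {a b} → m ≡ just a → m′ ≡ just b → R a b) → Connected R m m′
connected (just a) (just b) R-ab = just (R-ab refl refl)
connected (just a) nothing  _    = just-nothing
connected nothing  (just b) _    = nothing-just
connected nothing  nothing  _    = nothing

All-catMaybes⁺ : ∀ {A : Set} {R : A → A → Set} {a} {ms : List (Maybe A)} →
                 All (Connected R (just a)) ms → All (R a) (catMaybes ms)
All-catMaybes⁺ []                 = []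
All-catMaybes⁺ (just R-ab   ∷ rs) = R-ab ∷ All-catMaybes⁺ rs
All-catMaybes⁺ (just-nothing ∷ rs) = All-catMaybes⁺ rs

AllPairs-catMaybes⁺ : ∀ {A : Set} {R : A → A → Set} {ms : List (Maybe A)} →
                      AllPairs (Connected R) ms → AllPairs R (catMaybes ms)
AllPairs-catMaybes⁺ {ms = []}          []       = []
AllPairs-catMaybes⁺ {ms = nothing ∷ _} (_ ∷ rs) = AllPairs-catMaybes⁺ rs
AllPairs-catMaybes⁺ {ms = just a ∷ _}  (r ∷ rs) = All-catMaybes⁺ r ∷ AllPairs-catMaybes⁺ rs

sum-catMaybes : ∀ {A : Set} (f : A → ℕ) (ms : List (Maybe A)) →
                sum (map f (catMaybes ms)) ≡ sum (map (maybe′ f 0) ms)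
sum-catMaybes f []             = refl
sum-catMaybes f (just a  ∷ ms) = cong (f a +_) (sum-catMaybes f ms)
sum-catMaybes f (nothing ∷ ms) = sum-catMaybes f ms

-- Bollobás' inequality

rising : ℕ → ℕ → ℕ
rising m zero    = 1
rising m (suc r) = (m + suc r) * rising m r

rising*m!≡[m+r]! : ∀ m r → rising m r * m ! ≡ (m + r) !
rising*m!≡[m+r]! m zero    = trans (+-identityʳ (m !)) (cong _! (sym (+-identityʳ m)))
rising*m!≡[m+r]! m (suc r) = begin
  (m + suc r) * rising m r * m !   ≡⟨ *-assoc (m + suc r) (rising m r) (m !) ⟩
  (m + suc r) * (rising m r * m !) ≡⟨ cong ((m + suc r) *_) (rising*m!≡[m+r]! m r) ⟩
  (m + suc r) * (m + r) !          ≡⟨ cong (λ k → k * (m + r) !) (+-suc m r) ⟩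
  suc (m + r) !                    ≡⟨ cong _! (+-suc m r) ⟨
  (m + suc r) !                    ∎
  where open ≡-Reasoning

rising-peel : ∀ m r → rising m (suc r) ≡ suc m * rising (suc m) r
rising-peel m zero    = cong (_* 1) (+-comm m 1)
rising-peel m (suc r) = begin
  (m + suc (suc r)) * ((m + suc r) * rising m r) ≡⟨ cong ((m + suc (suc r)) *_) (rising-peel m r) ⟩
  (m + suc (suc r)) * (suc m * R)                ≡⟨ cong (_* (suc m * R)) (+-suc m (suc r)) ⟩
  (suc m + suc r) * (suc m * R)                  ≡⟨ x*[y*z]≡y*[x*z] (suc m + suc r) (suc m) R ⟩
  suc m * ((suc m + suc r) * R)                  ∎
  where
  open ≡-Reasoning
  R = rising (suc m) r

rising-pascal : ∀ m r → rising m r + r * rising (suc m) (r ∸ 1) ≡ rising (suc m) r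
rising-pascal m zero    = refl
rising-pascal m (suc r) = begin
  rising m (suc r) + suc r * R ≡⟨ cong (_+ suc r * R) (rising-peel m r) ⟩
  suc m * R + suc r * R        ≡⟨ *-distribʳ-+ R (suc m) (suc r) ⟨
  (suc m + suc r) * R          ∎
  where
  open ≡-Reasoning
  R = rising (suc m) r

-- n! / C(a + c, a) for n = a + c + r: the number of orderings of [n] putting all of A before
-- all of [n] ∖ B, where a = ∣A∣, c = ∣[n] ∖ B∣ and r = ∣B ∖ A∣.
weight : ℕ → ℕ → ℕ → ℕ
weight a c r = a ! * c ! * rising (a + c) r

weight*C≡! : ∀ a c r → weight a c r * ((a + c) C a) ≡ (a + c + r) !
weight*C≡! a c r = begin
  a ! * c ! * R * ((a + c) C a)
    ≡⟨ solve 4 (λ f g x y → f :* g :* x :* y := x :* (y :* (f :* g))) refl (a !) (c !) R ((a + c) C a) ⟩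
  R * (((a + c) C a) * (a ! * c !)) ≡⟨ cong (R *_) ([a+c]Ca*a!*c!≡[a+c]! a c) ⟩
  R * (a + c) !                     ≡⟨ rising*m!≡[m+r]! (a + c) r ⟩
  (a + c + r) !                     ∎
  where
  open ≡-Reasoning
  R = rising (a + c) r

-- Classify those orderings by their last point, which is not in A once [n] ∖ B is nonempty.
weight-step : ∀ a c r → suc c * weight a c r + r * weight a (suc c) (r ∸ 1) ≡ weight a (suc c) r
weight-step a c r rewrite +-suc a c = begin
  suc c * (a ! * c ! * X) + r * (a ! * (suc c * c !) * Y)
    ≡⟨ solve 6 (λ s f g x r y → s :* (f :* g :* x) :+ r :* (f :* (s :* g) :* y)
                                := f :* (s :* g) :* (x :+ r :* y))
               refl (suc c) (a !) (c !) X r Y ⟩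
  a ! * suc c ! * (X + r * Y)            ≡⟨ cong (a ! * suc c ! *_) (rising-pascal (a + c) r) ⟩
  a ! * suc c ! * rising (suc (a + c)) r ∎
  where
  open ≡-Reasoning
  X = rising (a + c) r
  Y = rising (suc (a + c)) (r ∸ 1)

weight≤! : ∀ a c r → weight a c r ≤ (a + c + r) !
weight≤! a c r = begin
  weight a c r                 ≤⟨ m≤m*n (weight a c r) ((a + c) C a) ⟩
  weight a c r * ((a + c) C a) ≡⟨ weight*C≡! a c r ⟩
  (a + c + r) !                ∎
  where
  open ≤-Reasoning
  instance _ = >-nonZero (0<nCk (m≤m+n a c))

-- A pair A ⊆ B of subsets of [n], recorded by the position of each point.
data Position : Set where
  inA inB∖A outB : Position

NestedPair : ℕ → Set
NestedPair = Vec Position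

δ : Position → Position → ℕ
δ inA   inA   = 1
δ inB∖A inB∖A = 1
δ outB  outB  = 1
δ _     _     = 0

count : ∀ {n} → Position → NestedPair n → ℕ
count p []      = 0
count p (q ∷ v) = δ p q + count p v

count-removeAt : ∀ {n} p (v : NestedPair (suc n)) x →
                 count p v ≡ δ p (lookup v x) + count p (removeAt v x)
count-removeAt p (q ∷ v)     zero    = refl
count-removeAt p (q ∷ r ∷ v) (suc x) = begin
  δ p q + count p (r ∷ v)     ≡⟨ cong (δ p q +_) (count-removeAt p (r ∷ v) x) ⟩
  δ p q + (δ p y + count p w) ≡⟨ x+[y+z]≡y+[x+z] (δ p q) (δ p y) (count p w) ⟩
  δ p y + (δ p q + count p w) ∎
  where
  open ≡-Reasoning
  y = lookup (r ∷ v) x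
  w = removeAt (r ∷ v) x

count-total : ∀ {n} (v : NestedPair n) → count inA v + count outB v + count inB∖A v ≡ n
count-total []          = refl
count-total (inA   ∷ v) = cong suc (count-total v)
count-total (outB  ∷ v) =
  trans (cong (_+ count inB∖A v) (+-suc (count inA v) (count outB v))) (cong suc (count-total v))
count-total (inB∖A ∷ v) =
  trans (+-suc (count inA v + count outB v) (count inB∖A v)) (cong suc (count-total v))

∑-lookup : ∀ {n} (G : Position → ℕ) (v : NestedPair n) →
           ∑[ x < n ] G (lookup v x) ≡
           count inA v * G inA + count outB v * G outB + count inB∖A v * G inB∖A
∑-lookup G []      = refl
∑-lookup G (p ∷ v) = trans (cong (G p +_) (∑-lookup G v)) (spread p)
  where
  a = count inA v
  c = count outB v
  r = count inB∖A v
  X = a * G inA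
  Y = c * G outB
  Z = r * G inB∖A
  spread : ∀ p → G p + (X + Y + Z) ≡
           (δ inA p + a) * G inA + (δ outB p + c) * G outB + (δ inB∖A p + r) * G inB∖A
  spread inA   = solve 4 (λ g x y z → g :+ (x :+ y :+ z) := (g :+ x) :+ y :+ z) refl (G inA) X Y Z
  spread outB  = solve 4 (λ g x y z → g :+ (x :+ y :+ z) := x :+ (g :+ y) :+ z) refl (G outB) X Y Z
  spread inB∖A = solve 4 (λ g x y z → g :+ (x :+ y :+ z) := x :+ y :+ (g :+ z)) refl (G inB∖A) X Y Z

pairWeight : ∀ {n} → NestedPair n → ℕ
pairWeight v = weight (count inA v) (count outB v) (count inB∖A v)

pairWeight≤! : ∀ {n} (v : NestedPair n) → pairWeight v ≤ n !
pairWeight≤! v =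
  subst (λ m → pairWeight v ≤ m !) (count-total v)
        (weight≤! (count inA v) (count outB v) (count inB∖A v))

-- Escapes p q says A ⊄ B′ for p = (A, B) and q = (A′, B′), so a crossing family is a
-- Bollobás set-pair system for the pairs (A, [n] ∖ B).
Escapes : ∀ {n} → NestedPair n → NestedPair n → Set
Escapes p q = ∃ λ y → lookup p y ≡ inA × lookup q y ≡ outB

Crossing : ∀ {n} → NestedPair n → NestedPair n → Set
Crossing p q = Escapes p q × Escapes q p

HasOuter : ∀ {n} → NestedPair n → Set
HasOuter v = ∃ λ y → lookup v y ≡ outB

escapes⇒hasOuter : ∀ {n} (p q : NestedPair n) → Escapes p q → HasOuter q
escapes⇒hasOuter p q (y , _ , qy≡outB) = y , qy≡outB

crossing⇒hasOuter : ∀ {n} {p q : NestedPair n} {vs} →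
                    AllPairs Crossing (p ∷ q ∷ vs) → All HasOuter (p ∷ q ∷ vs)
crossing⇒hasOuter {p = p} {q} (((p↗q , q↗p) ∷ p×vs) ∷ _) =
  escapes⇒hasOuter q p q↗p ∷ escapes⇒hasOuter p q p↗q ∷
  All.map (λ {v} → escapes⇒hasOuter p v ∘ proj₁) p×vs

survivor : ∀ {n} → Position → NestedPair n → Maybe (NestedPair n)
survivor inA   w = nothing
survivor outB  w = just w
survivor inB∖A w = just w

delete : ∀ {n} → Fin (suc n) → NestedPair (suc n) → Maybe (NestedPair n)
delete x v = survivor (lookup v x) (removeAt v x)

survivor-just : ∀ {n} t {w v : NestedPair n} → survivor t w ≡ just v → t ≢ inA × w ≡ v
survivor-just outB  refl = (λ ()) , refl
survivor-just inB∖A refl = (λ ()) , refl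

escapes-removeAt : ∀ {n} (p q : NestedPair (suc n)) x → lookup p x ≢ inA →
                   Escapes p q → Escapes (removeAt p x) (removeAt q x)
escapes-removeAt p q x px≢inA (y , py≡inA , qy≡outB) =
  punchOut x≢y , trans (removeAt-punchOut p x≢y) py≡inA , trans (removeAt-punchOut q x≢y) qy≡outB
  where
  x≢y : x ≢ y
  x≢y refl = px≢inA py≡inA

delete-crossing : ∀ {n} (x : Fin (suc n)) {p q : NestedPair (suc n)} →
                  Crossing p q → Connected Crossing (delete x p) (delete x q)
delete-crossing x {p} {q} (p↗q , q↗p) = connected (delete x p) (delete x q) crossing
  where
  crossing : ∀ {a b} → delete x p ≡ just a → delete x q ≡ just b → Crossing a b
  crossing dp dq with survivor-just (lookup p x) dp | survivor-just (lookup q x) dq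
  ... | px≢inA , refl | qx≢inA , refl =
    escapes-removeAt p q x px≢inA p↗q , escapes-removeAt q p x qx≢inA q↗p

deletionWeight : ℕ → ℕ → ℕ → Position → ℕ
deletionWeight a c r inA   = 0
deletionWeight a c r outB  = weight a (c ∸ 1) r
deletionWeight a c r inB∖A = weight a c (r ∸ 1)

weight-survivor : ∀ {n} t (w : NestedPair n) {a c r} →
  a ≡ δ inA t + count inA w → c ≡ δ outB t + count outB w → r ≡ δ inB∖A t + count inB∖A w →
  maybe′ pairWeight 0 (survivor t w) ≡ deletionWeight a c r t
weight-survivor inA   w _    _    _    = refl
weight-survivor outB  w refl refl refl = refl
weight-survivor inB∖A w refl refl refl = refl

pairWeight-expand : ∀ {n} (v : NestedPair (suc n)) y → lookup v y ≡ outB →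
                    pairWeight v ≡ ∑[ x < suc n ] maybe′ pairWeight 0 (delete x v)
pairWeight-expand {n} v y vy≡outB = begin
  weight a c r
    ≡⟨ cong (λ k → weight a k r) c≡1+c′ ⟩
  weight a (suc c′) r
    ≡⟨ weight-step a c′ r ⟨
  suc c′ * weight a c′ r + r * weight a (suc c′) (r ∸ 1)
    ≡⟨ cong (λ k → k * weight a (k ∸ 1) r + r * weight a k (r ∸ 1)) c≡1+c′ ⟨
  c * G outB + r * G inB∖A
    ≡⟨ cong (λ k → k + c * G outB + r * G inB∖A) (*-zeroʳ a) ⟨
  a * 0 + c * G outB + r * G inB∖A
    ≡⟨ ∑-lookup G v ⟨
  ∑[ x < suc n ] G (lookup v x)
    ≡⟨ sum-cong-≗ deleted ⟩
  ∑[ x < suc n ] maybe′ pairWeight 0 (delete x v) ∎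
  where
  open ≡-Reasoning
  a = count inA v
  c = count outB v
  r = count inB∖A v
  c′ = count outB (removeAt v y)
  c≡1+c′ : c ≡ suc c′
  c≡1+c′ = trans (count-removeAt outB v y) (cong (λ t → δ outB t + c′) vy≡outB)
  G = deletionWeight a c r
  deleted : ∀ x → G (lookup v x) ≡ maybe′ pairWeight 0 (delete x v)
  deleted x = sym (weight-survivor (lookup v x) (removeAt v x)
    (count-removeAt inA v x) (count-removeAt outB v x) (count-removeAt inB∖A v x))

bollobás : ∀ n (vs : List (NestedPair n)) → AllPairs Crossing vs → sum (map pairWeight vs) ≤ n !
bollobás n       []           _ = z≤n
bollobás n       (v ∷ [])     _ = subst (_≤ n !) (sym (+-identityʳ (pairWeight v))) (pairWeight≤! v)
bollobás zero    (p ∷ q ∷ vs) (((((() , _) , _) ∷ _) ∷ _))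
bollobás (suc n) vs@(_ ∷ _ ∷ _) crossing = begin
  sum (map pairWeight vs)                                      ≡⟨ cong sum (map-cong-local expanded) ⟩
  sum (map (λ v → ∑[ x < suc n ] deleted x v) vs)              ≡⟨ sum-map-∑ deleted vs ⟩
  ∑[ x < suc n ] sum (map (deleted x) vs)                      ≡⟨ sum-cong-≗ sum-deleted ⟩
  ∑[ x < suc n ] sum (map pairWeight (mapMaybe (delete x) vs)) ≤⟨ ∑-mono-≤ (λ x → bollobás n _ (crossing-after x)) ⟩
  ∑[ x < suc n ] (n !)                                         ≡⟨ ∑-const (suc n) (n !) ⟩
  suc n !                                                      ∎
  where
  open ≤-Reasoning
  deleted : Fin (suc n) → NestedPair (suc n) → ℕ
  deleted x v = maybe′ pairWeight 0 (delete x v)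
  expanded : All (λ v → pairWeight v ≡ ∑[ x < suc n ] deleted x v) vs
  expanded = All.map (λ {v} (y , vy≡outB) → pairWeight-expand v y vy≡outB) (crossing⇒hasOuter crossing)
  sum-deleted : ∀ x → sum (map (deleted x) vs) ≡ sum (map pairWeight (mapMaybe (delete x) vs))
  sum-deleted x = trans (cong sum (map-∘ {g = maybe′ pairWeight 0} {f = delete x} vs))
                        (sym (sum-catMaybes pairWeight (map (delete x) vs)))
  crossing-after : ∀ x → AllPairs Crossing (mapMaybe (delete x) vs)
  crossing-after x =
    AllPairs-catMaybes⁺ (AllPairs.map⁺ (AllPairs.map (λ {p} {q} → delete-crossing x {p} {q}) crossing))

!≤pairWeight*centralBinom : ∀ {n} h (v : NestedPair n) → h ≤ count inB∖A v →
                            n ! ≤ pairWeight v * centralBinom (n ∸ h)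
!≤pairWeight*centralBinom {n} h v h≤r = begin
  n !                              ≡⟨ cong _! (count-total v) ⟨
  (a + c + r) !                    ≡⟨ weight*C≡! a c r ⟨
  pairWeight v * ((a + c) C a)     ≤⟨ *-monoʳ-≤ (pairWeight v) (C≤centralBinom (a + c) a) ⟩
  pairWeight v * centralBinom (a + c) ≤⟨ *-monoʳ-≤ (pairWeight v) (centralBinom-mono a+c≤n∸h) ⟩
  pairWeight v * centralBinom (n ∸ h) ∎
  where
  open ≤-Reasoning
  a = count inA v
  c = count outB v
  r = count inB∖A v
  a+c≤n∸h : a + c ≤ n ∸ h
  a+c≤n∸h = begin
    a + c         ≡⟨ m+n∸n≡m (a + c) r ⟨
    a + c + r ∸ r ≡⟨ cong (_∸ r) (count-total v) ⟩
    n ∸ r         ≤⟨ ∸-monoʳ-≤ n h≤r ⟩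
    n ∸ h         ∎

-- Subsets

++⁺-⊆ : ∀ {k m} (p p′ : Subset k) {q q′ : Subset m} → p ⊆ p′ → q ⊆ q′ → p ++ q ⊆ p′ ++ q′
++⁺-⊆ []            []             _    q⊆q′ = q⊆q′
++⁺-⊆ (outside ∷ p) (_ ∷ p′)       p⊆p′ q⊆q′ = out⊆ (++⁺-⊆ p p′ (drop-∷-⊆ p⊆p′) q⊆q′)
++⁺-⊆ (inside ∷ p)  (inside ∷ p′)  p⊆p′ q⊆q′ = in⊆in (++⁺-⊆ p p′ (drop-∷-⊆ p⊆p′) q⊆q′)
++⁺-⊆ (inside ∷ p)  (outside ∷ p′) p⊆p′ _    = contradiction (p⊆p′ here) λ ()

++⁻ˡ-⊆ : ∀ {k m} (p p′ : Subset k) {q q′ : Subset m} → p ++ q ⊆ p′ ++ q′ → p ⊆ p′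
++⁻ˡ-⊆ []            []             _ ()
++⁻ˡ-⊆ (outside ∷ p) (_ ∷ p′)       s = out⊆ (++⁻ˡ-⊆ p p′ (drop-∷-⊆ s))
++⁻ˡ-⊆ (inside ∷ p)  (inside ∷ p′)  s = in⊆in (++⁻ˡ-⊆ p p′ (drop-∷-⊆ s))
++⁻ˡ-⊆ (inside ∷ p)  (outside ∷ p′) s = contradiction (s here) λ ()

++⁻ʳ-⊆ : ∀ {k m} (p p′ : Subset k) {q q′ : Subset m} → p ++ q ⊆ p′ ++ q′ → q ⊆ q′
++⁻ʳ-⊆ []      []       s = s
++⁻ʳ-⊆ (_ ∷ p) (_ ∷ p′) s = ++⁻ʳ-⊆ p p′ (drop-∷-⊆ s)

++⁺-⊂ : ∀ {k m} (p p′ : Subset k) {q : Subset m} → p ⊂ p′ → p ++ q ⊂ p′ ++ q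
++⁺-⊂ []            []             (_ , _ , () , _)
++⁺-⊂ (outside ∷ p) (outside ∷ p′) p⊂p′ = out⊂ (++⁺-⊂ p p′ (drop-∷-⊂ p⊂p′))
++⁺-⊂ (inside ∷ p)  (inside ∷ p′)  p⊂p′ = s⊂s (++⁺-⊂ p p′ (drop-∷-⊂ p⊂p′))
++⁺-⊂ (outside ∷ p) (inside ∷ p′)  p⊂p′ = out⊂in (++⁺-⊆ p p′ (drop-∷-⊆ (proj₁ p⊂p′)) ⊆-refl)
++⁺-⊂ (inside ∷ p)  (outside ∷ p′) p⊂p′ = contradiction (proj₁ p⊂p′ here) λ ()

++⁻-⊂ : ∀ {k m} (p p′ : Subset k) {q : Subset m} → p ++ q ⊂ p′ ++ q → p ⊂ p′
++⁻-⊂ []            []             (_ , _ , x∈q , x∉q) = contradiction x∈q x∉q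
++⁻-⊂ (outside ∷ p) (outside ∷ p′) s = out⊂ (++⁻-⊂ p p′ (drop-∷-⊂ s))
++⁻-⊂ (inside ∷ p)  (inside ∷ p′)  s = s⊂s (++⁻-⊂ p p′ (drop-∷-⊂ s))
++⁻-⊂ (outside ∷ p) (inside ∷ p′)  s = out⊂in (++⁻ˡ-⊆ p p′ (drop-∷-⊆ (proj₁ s)))
++⁻-⊂ (inside ∷ p)  (outside ∷ p′) s = contradiction (proj₁ s here) λ ()

∃∈∉-∷ : ∀ {n s t} {p q : Subset n} → (∃ λ x → x ∈ p × x ∉ q) → ∃ λ x → x ∈ s ∷ p × x ∉ t ∷ q
∃∈∉-∷ (x , x∈p , x∉q) = suc x , there x∈p , x∉q ∘ drop-there

⊈⇒∃∈∉ : ∀ {n} (p q : Subset n) → ¬ (p ⊆ q) → ∃ λ x → x ∈ p × x ∉ q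
⊈⇒∃∈∉ []            []             p⊈q = contradiction (λ ()) p⊈q
⊈⇒∃∈∉ (inside ∷ p)  (outside ∷ q)  _   = zero , here , λ ()
⊈⇒∃∈∉ (outside ∷ p) (_ ∷ q)        p⊈q = ∃∈∉-∷ (⊈⇒∃∈∉ p q (p⊈q ∘ out⊆))
⊈⇒∃∈∉ (inside ∷ p)  (inside ∷ q)   p⊈q = ∃∈∉-∷ (⊈⇒∃∈∉ p q (p⊈q ∘ in⊆in))

∉⇒lookup≡outside : ∀ {n} {x : Fin n} (p : Subset n) → x ∉ p → lookup p x ≡ outside
∉⇒lookup≡outside {x = x} p x∉p with lookup p x in px
... | true  = contradiction (lookup⇒[]= x p px) x∉p
... | false = refl

position : Bool → Bool → Position
position true  _     = inA
position false true  = inB∖A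
position false false = outB

positions : ∀ {n} → Subset n → Subset n → NestedPair n
positions = zipWith position

∣B∣≤∣A∣+count-inB∖A : ∀ {n} (A B : Subset n) → ∣ B ∣ ≤ ∣ A ∣ + count inB∖A (positions A B)
∣B∣≤∣A∣+count-inB∖A []          []          = z≤n
∣B∣≤∣A∣+count-inB∖A (true  ∷ A) (true  ∷ B) = s≤s (∣B∣≤∣A∣+count-inB∖A A B)
∣B∣≤∣A∣+count-inB∖A (true  ∷ A) (false ∷ B) = m≤n⇒m≤1+n (∣B∣≤∣A∣+count-inB∖A A B)
∣B∣≤∣A∣+count-inB∖A (false ∷ A) (true  ∷ B) =
  subst (suc ∣ B ∣ ≤_) (sym (+-suc ∣ A ∣ _)) (s≤s (∣B∣≤∣A∣+count-inB∖A A B))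
∣B∣≤∣A∣+count-inB∖A (false ∷ A) (false ∷ B) = ∣B∣≤∣A∣+count-inB∖A A B

positions-escape : ∀ {n} {A B A′ B′ : Subset n} {x} → A′ ⊆ B′ → x ∈ A → x ∉ B′ →
                   Escapes (positions A B) (positions A′ B′)
positions-escape {A = A} {B} {A′} {B′} {x} A′⊆B′ x∈A x∉B′ = x ,
  trans (lookup-zipWith position x A B) (cong (λ b → position b (lookup B x)) ([]=⇒lookup x∈A)) ,
  trans (lookup-zipWith position x A′ B′)
    (cong₂ position (∉⇒lookup≡outside A′ (x∉B′ ∘ A′⊆B′)) (∉⇒lookup≡outside B′ x∉B′))

pascal-split : ∀ m k → Fin (suc m C suc k) → Fin (m C k) ⊎ Fin (m C suc k)
pascal-split m k i = splitAt (m C k) (cast (sym (nCk+nC[k+1]≡[n+1]C[k+1] m k)) i)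

pascal-split-injective : ∀ m k {i j} → pascal-split m k i ≡ pascal-split m k j → i ≡ j
pascal-split-injective m k {i} {j} eq = begin
  i                                      ≡⟨ cast-involutive e (sym e) i ⟨
  cast e (cast (sym e) i)                ≡⟨ cong (cast e) (join-splitAt (m C k) (m C suc k) (cast (sym e) i)) ⟨
  cast e (join _ _ (pascal-split m k i)) ≡⟨ cong (cast e ∘ join _ _) eq ⟩
  cast e (join _ _ (pascal-split m k j)) ≡⟨ cong (cast e) (join-splitAt (m C k) (m C suc k) (cast (sym e) j)) ⟩
  cast e (cast (sym e) j)                ≡⟨ cast-involutive e (sym e) j ⟩
  j                                      ∎
  where
  open ≡-Reasoning
  e = nCk+nC[k+1]≡[n+1]C[k+1] m k

-- The k-subsets of [m], enumerated along Pascal's rule.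
layer : ∀ m k → Fin (m C k) → Subset m
layer-∷ : ∀ m k → Fin (m C k) ⊎ Fin (m C suc k) → Subset (suc m)

layer m       zero    _ = ⊥
layer zero    (suc k) ()
layer (suc m) (suc k) i = layer-∷ m k (pascal-split m k i)

layer-∷ m k (inj₁ j) = inside  ∷ layer m k j
layer-∷ m k (inj₂ j) = outside ∷ layer m (suc k) j

∣layer∣≡k : ∀ m k i → ∣ layer m k i ∣ ≡ k
∣layer-∷∣≡1+k : ∀ m k s → ∣ layer-∷ m k s ∣ ≡ suc k

∣layer∣≡k m       zero    i = ∣⊥∣≡0 m
∣layer∣≡k (suc m) (suc k) i = ∣layer-∷∣≡1+k m k (pascal-split m k i)

∣layer-∷∣≡1+k m k (inj₁ j) = cong suc (∣layer∣≡k m k j)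
∣layer-∷∣≡1+k m k (inj₂ j) = ∣layer∣≡k m (suc k) j

layer-⊆⇒≡ : ∀ m k {i j} → layer m k i ⊆ layer m k j → i ≡ j
layer-∷-⊆⇒≡ : ∀ m k {s t} → layer-∷ m k s ⊆ layer-∷ m k t → s ≡ t

layer-⊆⇒≡ m       zero    {zero} {zero} _ = refl
layer-⊆⇒≡ (suc m) (suc k) ⊆ = pascal-split-injective m k (layer-∷-⊆⇒≡ m k ⊆)

layer-∷-⊆⇒≡ m k {inj₁ i} {inj₁ j} ⊆ = cong inj₁ (layer-⊆⇒≡ m k (drop-∷-⊆ ⊆))
layer-∷-⊆⇒≡ m k {inj₂ i} {inj₂ j} ⊆ = cong inj₂ (layer-⊆⇒≡ m (suc k) (drop-∷-⊆ ⊆))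
layer-∷-⊆⇒≡ m k {inj₁ i} {inj₂ j} ⊆ = contradiction (⊆ here) λ ()
layer-∷-⊆⇒≡ m k {inj₂ i} {inj₁ j} ⊆ = contradiction
  (subst₂ _≤_ (∣layer∣≡k m (suc k) i) (∣layer∣≡k m k j) (p⊆q⇒∣p∣≤∣q∣ (drop-∷-⊆ ⊆))) 1+n≰n

-- Embeddings of P

induced⇒embedding : ∀ P {n} {f : Fin (size P) → Subset n} →
                    IsInducedEmbedding P n f → IsEmbedding P n f
induced⇒embedding P (f-injective , f-mono , _) = f-injective , f-mono

++-embedding : ∀ P {h m} {f : Fin (size P) → Subset h} (q : Subset m) →
               IsEmbedding P h f → IsEmbedding P (h + m) (λ a → f a ++ q)
++-embedding P {f = f} q (f-injective , f-mono) =
  (λ {a} {b} eq → f-injective (++-injectiveˡ (f a) (f b) eq)) ,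
  (λ a b a<b → ++⁺-⊂ (f a) (f b) (f-mono a b a<b))

++-inducedEmbedding : ∀ P {h m} {f : Fin (size P) → Subset h} (q : Subset m) →
                      IsInducedEmbedding P h f → IsInducedEmbedding P (h + m) (λ a → f a ++ q)
++-inducedEmbedding P {f = f} q f-induced@(_ , _ , f-reflects) =
  let injective , mono = ++-embedding P q (induced⇒embedding P f-induced)
  in  injective , mono , λ a b fa⊂fb → f-reflects a b (++⁻-⊂ (f a) (f b) fa⊂fb)

layered-incomparable : ∀ P {h} m k (f : Fin (size P) → Subset h) →
                       IncomparableFamily P (h + m) (m C k) (λ i a → f a ++ layer m k i)
layered-incomparable P m k f i j i≢j a b fa⊆fb = i≢j (layer-⊆⇒≡ m k (++⁻ʳ-⊆ (f a) (f b) fa⊆fb))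

chain-image : ∀ P {n} {f : Fin (size P) → Subset n} → (∀ a b → _<ₚ_ P a b → f a ⊂ f b) →
              ∀ {k} (c : Vec (Fin (size P)) (suc k)) → IsChain P c →
              f (head c) ⊆ f (last c) × ∣ f (head c) ∣ + k ≤ ∣ f (last c) ∣
chain-image P {f = f} f-mono         (x ∷ [])     _                  =
  ⊆-refl , ≤-reflexive (+-identityʳ ∣ f x ∣)
chain-image P {f = f} f-mono {suc k} (x ∷ y ∷ xs) (x<y , y∷xs-chain) =
  ⊆-trans (p⊂q⇒p⊆q fx⊂fy) fy⊆top , (begin
    ∣ f x ∣ + suc k       ≡⟨ +-suc ∣ f x ∣ k ⟩
    suc ∣ f x ∣ + k       ≤⟨ +-monoˡ-≤ k (p⊂q⇒∣p∣<∣q∣ fx⊂fy) ⟩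
    ∣ f y ∣ + k           ≤⟨ ∣fy∣+k≤∣top∣ ⟩
    ∣ f (last (y ∷ xs)) ∣ ∎)
  where
  open ≤-Reasoning
  fx⊂fy = f-mono x y x<y
  rest = chain-image P f-mono (y ∷ xs) y∷xs-chain
  fy⊆top = proj₁ rest
  ∣fy∣+k≤∣top∣ = proj₂ rest

embeddings-bound : ∀ P h → IsHeight P h → ∀ n M (fs : Fin M → Fin (size P) → Subset n) →
                   (∀ i → IsEmbedding P n (fs i)) → IncomparableFamily P n M fs →
                   M ≤ centralBinom (n ∸ h)
embeddings-bound P h ((c , c-chain) , _) n M fs fs-embedding incomparable =
  *-cancelʳ-≤ M K (n !) {{n !≢0}} (begin
    M * n !                               ≡⟨ ∑-const M (n !) ⟨
    ∑[ i < M ] (n !)                      ≤⟨ ∑-mono-≤ (λ i → !≤pairWeight*centralBinom h (v i) (h≤r i)) ⟩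
    ∑[ i < M ] (pairWeight (v i) * K)     ≡⟨ *-distribʳ-sum K (pairWeight ∘ v) ⟨
    (∑[ i < M ] pairWeight (v i)) * K     ≡⟨ cong (_* K) (sum-map-tabulate pairWeight v) ⟨
    sum (map pairWeight (tabulate v)) * K ≤⟨ *-monoˡ-≤ K (bollobás n (tabulate v) (AllPairs.tabulate⁺ crossing)) ⟩
    n ! * K                               ≡⟨ *-comm (n !) K ⟩
    K * n !                               ∎)
  where
  open ≤-Reasoning
  K = centralBinom (n ∸ h)
  A B : Fin M → Subset n
  A i = fs i (head c)
  B i = fs i (last c)
  v : Fin M → NestedPair n
  v i = positions (A i) (B i)
  image : ∀ i → A i ⊆ B i × ∣ A i ∣ + h ≤ ∣ B i ∣
  image i = chain-image P (proj₂ (fs-embedding i)) c c-chain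
  h≤r : ∀ i → h ≤ count inB∖A (v i)
  h≤r i = +-cancelˡ-≤ ∣ A i ∣ h _ (≤-trans (proj₂ (image i)) (∣B∣≤∣A∣+count-inB∖A (A i) (B i)))
  escape : ∀ {i j} → i ≢ j → Escapes (v i) (v j)
  escape {i} {j} i≢j with ⊈⇒∃∈∉ (A i) (B j) (incomparable i j i≢j (head c) (last c))
  ... | x , x∈Ai , x∉Bj = positions-escape (proj₁ (image j)) x∈Ai x∉Bj
  crossing : ∀ {i j} → i ≢ j → Crossing (v i) (v j)
  crossing i≢j = escape i≢j , escape (i≢j ∘ sym)

slim⇒thin : ∀ P {h} → Slim P h → Thin P h
slim⇒thin P (f , f-induced) = f , induced⇒embedding P f-induced

thin⇒M₁ : ∀ P h → IsHeight P h → Thin P h → ∀ m → IsM₁ P (h + m) (centralBinom m)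
thin⇒M₁ P h height (f , f-embedding) m =
  ((λ i a → f a ++ layer m (m / 2) i) ,
   (λ i → ++-embedding P (layer m (m / 2) i) f-embedding) ,
   layered-incomparable P m (m / 2) f) ,
  λ M fs fs-embedding incomparable →
    subst (M ≤_) (cong centralBinom (m+n∸m≡n h m))
      (embeddings-bound P h height (h + m) M fs fs-embedding incomparable)

slim⇒M₂ : ∀ P h → IsHeight P h → Slim P h → ∀ m → IsM₂ P (h + m) (centralBinom m)
slim⇒M₂ P h height (f , f-induced) m =
  ((λ i a → f a ++ layer m (m / 2) i) ,
   (λ i → ++-inducedEmbedding P (layer m (m / 2) i) f-induced) ,
   layered-incomparable P m (m / 2) f) ,
  λ M fs fs-induced incomparable →
    subst (M ≤_) (cong centralBinom (m+n∸m≡n h m))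
      (embeddings-bound P h height (h + m) M fs (induced⇒embedding P ∘ fs-induced) incomparable)

from-offset : ∀ {ℓ} (Q : ℕ → ℕ → Set ℓ) h → (∀ m → Q (h + m) (centralBinom m)) →
              ∀ n → h ≤ n → Q n (centralBinom (n ∸ h))
from-offset Q h Q-offset n h≤n with m≤n⇒∃[o]m+o≡n h≤n
... | m , refl = subst (Q (h + m)) (cong centralBinom (sym (m+n∸m≡n h m))) (Q-offset m)

theorem6 : (P : FinPoset) (h : ℕ) → IsHeight P h →
    (Thin P h → ∀ n → h ≤ n → IsM₁ P n (centralBinom (n ∸ h))) ×
    (Slim P h → ∀ n → h ≤ n →
      IsM₁ P n (centralBinom (n ∸ h)) × IsM₂ P n (centralBinom (n ∸ h)))
theorem6 P h height =
  (λ thin → from-offset (IsM₁ P) h (thin⇒M₁ P h height thin)) ,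
  (λ slim → from-offset (λ n M → IsM₁ P n M × IsM₂ P n M) h
              (λ m → thin⇒M₁ P h height (slim⇒thin P slim) m , slim⇒M₂ P h height slim m))
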